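{- Let $r\ge 2$, $n=2^r$, $M=2^{n-r}$, and let $\hat{\mathcal{C}}\subseteq\mathbb{F}_2^{n+1}$ be a diamond code with $2M$ codewords. Then the graph whose vertices are the codewords of $\hat{\mathcal{C}}$, two codewords being adjacent when they are at Hamming distance $1$, is a disjoint union of cycles of length $4$; each such cycle contains one codeword of weight $k$, for some $0\le k\le n-1$, two codewords of weight $k+1$ and one codeword of weight $k+2$. Moreover, every codeword not on a given cycle is at distance at least $3$ from each codeword of that cycle.
   Context: All codes are binary; Hamming distance and Hamming weight are used. A diamond code of length $m$ is a code $\hat{\mathcal{C}}\subseteq\mathbb{F}_2^m$, nonempty with nonempty complement, such that every codeword has exactly $2$ codewords (and hence $m-2$ non-codewords) at distance $1$, and every non-codeword has exactly $1$ codeword (and hence $m-1$ non-codewords) at distance $1$. -}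

module Defs where

open import Data.Bool using (Bool; true; false; _xor_; _∧_; not)
open import Data.Nat using (ℕ; zero; suc; _+_; _≡ᵇ_)
open import Data.List using (List; []; _∷_; _++_; map; length; filterᵇ)
open import Data.Vec using (Vec; []; _∷_; zipWith)
open import Data.Product using (∃; _×_)
open import Relation.Binary.PropositionalEquality using (_≡_)

Word : ℕ → Set
Word m = Vec Bool m

weight : ∀ {m} → Word m → ℕ
weight []          = 0
weight (true ∷ v)  = suc (weight v)
weight (false ∷ v) = weight v

dist : ∀ {m} → Word m → Word m → ℕ
dist u v = weight (zipWith _xor_ u v)

allWords : (m : ℕ) → List (Word m)
allWords zero    = [] ∷ []
allWords (suc m) = map (true ∷_) (allWords m) ++ map (false ∷_) (allWords m)

Code : ℕ → Set
Code m = Word m → Bool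

size : ∀ {m} → Code m → ℕ
size {m} C = length (filterᵇ C (allWords m))

codeNbrs : ∀ {m} → Code m → Word m → ℕ
codeNbrs {m} C w = length (filterᵇ (λ v → C v ∧ (dist w v ≡ᵇ 1)) (allWords m))

record IsDiamond {m : ℕ} (C : Code m) : Set where
  field
    nonempty     : ∃ λ w → C w ≡ true
    cononempty   : ∃ λ w → C w ≡ false
    codeword-deg : ∀ w → C w ≡ true  → codeNbrs C w ≡ 2
    noncode-deg  : ∀ w → C w ≡ false → codeNbrs C w ≡ 1

{-# OPTIONS --safe #-}
-- A codeword x has two codeword neighbours flip i x and flip j x (i ≢ j). The word
-- flip i (flip j x) is adjacent to both, and a non-codeword has only one codeword neighbour,
-- so it is a codeword too: the four words obtained from x by flipping a subset of {i, j}
-- form a 4-cycle of codewords. Each of them already has its two codeword neighbours on the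
-- cycle, so no other codeword is adjacent to it; and a codeword y at distance 2 from a cycle
-- vertex v is reached through a word u which, if a codeword, lies on the cycle (so y would
-- too), and otherwise would have the two codeword neighbours v ≠ y. Taking as base the corner
-- that is 0 at i and j gives the weights.
module Submission where

open import Defs
open import Data.Bool using (Bool; true; false; not; _xor_; _∧_)
open import Data.Bool.Properties
  using (T?; T-≡; T-∧; not-¬; not-involutive; xor-comm; xor-same; xor-identityʳ)
open import Data.Fin using (Fin; zero; suc)
open import Data.List using (List; []; _∷_; map; length; filterᵇ)
open import Data.List.Membership.Propositional using (_∈_)
open import Data.List.Membership.Propositional.Properties
  using (∈-filter⁺; ∈-filter⁻; ∈-map⁺; ∈-map⁻; ∈-++⁺ˡ; ∈-++⁺ʳ)
open import Data.List.Relation.Unary.All using ([]; _∷_)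
open import Data.List.Relation.Unary.AllPairs using ([]; _∷_)
open import Data.List.Relation.Unary.Any using (here; there)
open import Data.List.Relation.Unary.Unique.Propositional using (Unique)
import Data.List.Relation.Unary.Unique.Propositional.Properties as Unique
open import Data.Nat using (ℕ; zero; suc; _+_; _*_; _∸_; _^_; _≤_; _≥_; _≡ᵇ_; z≤n; s≤s)
open import Data.Nat.Properties
  using (≡ᵇ⇒≡; ≡⇒≡ᵇ; suc-injective; +-comm; +-assoc; m≤n⇒m≤1+n; m≤m+n; +-cancelʳ-≤; m+n≤o⇒m≤o∸n)
open import Data.Product using (Σ; ∃; ∃₂; _×_; _,_; proj₂)
open import Data.Sum using (_⊎_; inj₁; inj₂)
open import Data.Vec using (_∷_; []; lookup; updateAt)
open import Data.Vec.Properties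
  using (∷-injectiveʳ; updateAt-updateAt-local; updateAt-id; updateAt-commutes;
         lookup∘updateAt; lookup∘updateAt′; zipWith-comm)
open import Function using (id; _∘_; Equivalence)
open import Relation.Binary.PropositionalEquality
  using (_≡_; _≢_; refl; sym; trans; cong; cong₂; subst; module ≡-Reasoning)
open import Relation.Nullary using (¬_; contradiction)

private
  variable
    A : Set
    m : ℕ
    a b : Bool
    i j : Fin m
    c s t u v w x y z : Word m

m+2≤n+1⇒m≤n∸1 : ∀ k n → k + 2 ≤ n + 1 → k ≤ n ∸ 1
m+2≤n+1⇒m≤n∸1 k n le =
  m+n≤o⇒m≤o∸n k (+-cancelʳ-≤ 1 (k + 1) n (subst (_≤ n + 1) (sym (+-assoc k 1 1)) le))

∈-length≡1 : ∀ {xs : List A} {x y} → length xs ≡ 1 → x ∈ xs → y ∈ xs → x ≡ y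
∈-length≡1 {xs = _ ∷ []} _ (here refl) (here refl) = refl

∈-length≡2 : ∀ {xs : List A} {x y z} → length xs ≡ 2 → x ≢ y → x ∈ xs → y ∈ xs → z ∈ xs →
             z ≡ x ⊎ z ≡ y
∈-length≡2 {xs = _ ∷ _ ∷ []} _ x≢y (here refl) (here refl) _ = contradiction refl x≢y
∈-length≡2 {xs = _ ∷ _ ∷ []} _ x≢y (there (here refl)) (there (here refl)) _ = contradiction refl x≢y
∈-length≡2 {xs = _ ∷ _ ∷ []} _ _ (here refl) (there (here refl)) (here refl) = inj₁ refl
∈-length≡2 {xs = _ ∷ _ ∷ []} _ _ (here refl) (there (here refl)) (there (here refl)) = inj₂ refl
∈-length≡2 {xs = _ ∷ _ ∷ []} _ _ (there (here refl)) (here refl) (here refl) = inj₂ refl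
∈-length≡2 {xs = _ ∷ _ ∷ []} _ _ (there (here refl)) (here refl) (there (here refl)) = inj₁ refl

unique-length≡2 : ∀ {xs : List A} → Unique xs → length xs ≡ 2 → ∃₂ λ x y → x ≢ y × x ∈ xs × y ∈ xs
unique-length≡2 {xs = x ∷ y ∷ []} ((x≢y ∷ _) ∷ _) _ = x , y , x≢y , here refl , there (here refl)

∈-allWords : (w : Word m) → w ∈ allWords m
∈-allWords []          = here refl
∈-allWords (true ∷ w)  = ∈-++⁺ˡ (∈-map⁺ (true ∷_) (∈-allWords w))
∈-allWords (false ∷ w) = ∈-++⁺ʳ _ (∈-map⁺ (false ∷_) (∈-allWords w))

allWords-unique : ∀ m → Unique (allWords m)
allWords-unique zero    = [] ∷ []
allWords-unique (suc m) = Unique.++⁺ (unique true) (unique false) disjoint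
  where
  unique : ∀ b → Unique (map (b ∷_) (allWords m))
  unique b = Unique.map⁺ ∷-injectiveʳ (allWords-unique m)
  disjoint : ∀ {v} → ¬ (v ∈ map (true ∷_) (allWords m) × v ∈ map (false ∷_) (allWords m))
  disjoint (p , q) with ∈-map⁻ (true ∷_) p | ∈-map⁻ (false ∷_) q
  ... | _ , _ , refl | _ , _ , ()

≢-at : lookup u i ≡ b → lookup v i ≡ not b → u ≢ v
≢-at uᵢ vᵢ refl = not-¬ refl (trans (sym uᵢ) vᵢ)

flip : Fin m → Word m → Word m
flip i w = updateAt w i not

flip-involutive : (i : Fin m) (w : Word m) → flip i (flip i w) ≡ w
flip-involutive i w =
  trans (updateAt-updateAt-local i {h = id} w (not-involutive _)) (updateAt-id i w)

flip-comm : i ≢ j → (w : Word m) → flip i (flip j w) ≡ flip j (flip i w)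
flip-comm {i = i} {j} i≢j w = updateAt-commutes i j i≢j w

flip-≢ : i ≢ j → (w : Word m) → flip i w ≢ flip j w
flip-≢ {i = i} {j} i≢j w e = ≢-at (lookup∘updateAt′ i j i≢j w) (lookup∘updateAt i w) (sym e)

weight-flip : (i : Fin m) (w : Word m) → lookup w i ≡ false → weight (flip i w) ≡ weight w + 1
weight-flip zero    (false ∷ w) _  = +-comm 1 (weight w)
weight-flip (suc i) (true ∷ w)  wᵢ = cong suc (weight-flip i w wᵢ)
weight-flip (suc i) (false ∷ w) wᵢ = weight-flip i w wᵢ

weight≤length : (w : Word m) → weight w ≤ m
weight≤length []          = z≤n
weight≤length (true ∷ w)  = s≤s (weight≤length w)
weight≤length (false ∷ w) = m≤n⇒m≤1+n (weight≤length w)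

dist-comm : (u v : Word m) → dist u v ≡ dist v u
dist-comm u v = cong weight (zipWith-comm xor-comm u v)

dist-self : (w : Word m) → dist w w ≡ 0
dist-self []          = refl
dist-self (true ∷ w)  = dist-self w
dist-self (false ∷ w) = dist-self w

dist≡0⇒≡ : (u v : Word m) → dist u v ≡ 0 → u ≡ v
dist≡0⇒≡ []          []          _ = refl
dist≡0⇒≡ (true ∷ u)  (true ∷ v)  d = cong (true ∷_) (dist≡0⇒≡ u v d)
dist≡0⇒≡ (false ∷ u) (false ∷ v) d = cong (false ∷_) (dist≡0⇒≡ u v d)

dist-flip : (i : Fin m) (w : Word m) → dist w (flip i w) ≡ 1
dist-flip zero    (true ∷ w)  = cong suc (dist-self w)
dist-flip zero    (false ∷ w) = cong suc (dist-self w)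
dist-flip (suc i) (true ∷ w)  = dist-flip i w
dist-flip (suc i) (false ∷ w) = dist-flip i w

dist≡1⇒flip : (u v : Word m) → dist u v ≡ 1 → ∃ λ i → v ≡ flip i u
dist≡1⇒flip [] [] ()
dist≡1⇒flip (true ∷ u) (true ∷ v) d with dist≡1⇒flip u v d
... | i , refl = suc i , refl
dist≡1⇒flip (false ∷ u) (false ∷ v) d with dist≡1⇒flip u v d
... | i , refl = suc i , refl
dist≡1⇒flip (true ∷ u) (false ∷ v) d with dist≡0⇒≡ u v (suc-injective d)
... | refl = zero , refl
dist≡1⇒flip (false ∷ u) (true ∷ v) d with dist≡0⇒≡ u v (suc-injective d)
... | refl = zero , refl

dist≡2⇒flip² : (u v : Word m) → dist u v ≡ 2 → ∃₂ λ i j → v ≡ flip i (flip j u)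
dist≡2⇒flip² [] [] ()
dist≡2⇒flip² (true ∷ u) (true ∷ v) d with dist≡2⇒flip² u v d
... | i , j , refl = suc i , suc j , refl
dist≡2⇒flip² (false ∷ u) (false ∷ v) d with dist≡2⇒flip² u v d
... | i , j , refl = suc i , suc j , refl
dist≡2⇒flip² (true ∷ u) (false ∷ v) d with dist≡1⇒flip u v (suc-injective d)
... | j , refl = zero , suc j , refl
dist≡2⇒flip² (false ∷ u) (true ∷ v) d with dist≡1⇒flip u v (suc-injective d)
... | j , refl = zero , suc j , refl

flipIf : Bool → Fin m → Word m → Word m
flipIf false _ w = w
flipIf true  i w = flip i w

flipIf-xor : ∀ a b (i : Fin m) w → flipIf a i (flipIf b i w) ≡ flipIf (a xor b) i w
flipIf-xor false b     i w = refl
flipIf-xor true  false i w = refl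
flipIf-xor true  true  i w = flip-involutive i w

flipIf-comm : i ≢ j → ∀ a b (w : Word m) → flipIf a i (flipIf b j w) ≡ flipIf b j (flipIf a i w)
flipIf-comm i≢j false b     w = refl
flipIf-comm i≢j true  false w = refl
flipIf-comm i≢j true  true  w = flip-comm i≢j w

lookup-flipIf : ∀ a (i : Fin m) w → lookup (flipIf a i w) i ≡ a xor lookup w i
lookup-flipIf false i w = refl
lookup-flipIf true  i w = lookup∘updateAt i w

lookup-flipIf-≢ : i ≢ j → ∀ a (w : Word m) → lookup (flipIf a j w) i ≡ lookup w i
lookup-flipIf-≢ i≢j false w = refl
lookup-flipIf-≢ {i = i} {j} i≢j true w = lookup∘updateAt′ i j i≢j w

corner : Fin m → Fin m → Word m → Bool → Bool → Word m
corner i j c a b = flipIf a i (flipIf b j c)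

module _ {i j : Fin m} (i≢j : i ≢ j) where

  flip-cornerˡ : ∀ c a b → flip i (corner i j c a b) ≡ corner i j c (not a) b
  flip-cornerˡ c a b = flipIf-xor true a i (flipIf b j c)

  flip-cornerʳ : ∀ c a b → flip j (corner i j c a b) ≡ corner i j c a (not b)
  flip-cornerʳ c a b = trans (flipIf-comm (i≢j ∘ sym) true a (flipIf b j c))
                             (cong (flipIf a i) (flipIf-xor true b j c))

  corner-corner : ∀ c a b a′ b′ →
                  corner i j (corner i j c a b) a′ b′ ≡ corner i j c (a′ xor a) (b′ xor b)
  corner-corner c a b a′ b′ = begin
    flipIf a′ i (flipIf b′ j (flipIf a i (flipIf b j c)))
      ≡⟨ cong (flipIf a′ i) (flipIf-comm i≢j a b′ _) ⟨
    flipIf a′ i (flipIf a i (flipIf b′ j (flipIf b j c)))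
      ≡⟨ flipIf-xor a′ a i _ ⟩
    flipIf (a′ xor a) i (flipIf b′ j (flipIf b j c))
      ≡⟨ cong (flipIf (a′ xor a) i) (flipIf-xor b′ b j c) ⟩
    flipIf (a′ xor a) i (flipIf (b′ xor b) j c)
      ∎
    where open ≡-Reasoning

  lookup-cornerˡ : ∀ c a b → lookup (corner i j c a b) i ≡ a xor lookup c i
  lookup-cornerˡ c a b = trans (lookup-flipIf a i _) (cong (a xor_) (lookup-flipIf-≢ i≢j b c))

  lookup-cornerʳ : ∀ c a b → lookup (corner i j c a b) j ≡ b xor lookup c j
  lookup-cornerʳ c a b = begin
    lookup (flipIf a i (flipIf b j c)) j ≡⟨ cong (λ v → lookup v j) (flipIf-comm i≢j a b c) ⟩
    lookup (flipIf b j (flipIf a i c)) j ≡⟨ lookup-flipIf b j _ ⟩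
    b xor lookup (flipIf a i c) j        ≡⟨ cong (b xor_) (lookup-flipIf-≢ (i≢j ∘ sym) a c) ⟩
    b xor lookup c j                     ∎
    where open ≡-Reasoning

  dist-cornerˡ : ∀ c a b → dist (corner i j c a b) (corner i j c (not a) b) ≡ 1
  dist-cornerˡ c a b =
    subst (λ v → dist (corner i j c a b) v ≡ 1) (flip-cornerˡ c a b) (dist-flip i (corner i j c a b))

  dist-cornerʳ : ∀ c a b → dist (corner i j c a b) (corner i j c a (not b)) ≡ 1
  dist-cornerʳ c a b =
    subst (λ v → dist (corner i j c a b) v ≡ 1) (flip-cornerʳ c a b) (dist-flip j (corner i j c a b))

  corner-neighbours-distinct : ∀ c a b → corner i j c (not a) b ≢ corner i j c a (not b)
  corner-neighbours-distinct c a b e =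
    flip-≢ i≢j _ (trans (flip-cornerˡ c a b) (trans e (sym (flip-cornerʳ c a b))))

  lookup-base-cornerˡ : ∀ {c} → lookup c i ≡ false → ∀ a b → lookup (corner i j c a b) i ≡ a
  lookup-base-cornerˡ {c} cᵢ a b =
    trans (lookup-cornerˡ c a b) (trans (cong (a xor_) cᵢ) (xor-identityʳ a))

  lookup-base-cornerʳ : ∀ {c} → lookup c j ≡ false → ∀ a b → lookup (corner i j c a b) j ≡ b
  lookup-base-cornerʳ {c} cⱼ a b =
    trans (lookup-cornerʳ c a b) (trans (cong (b xor_) cⱼ) (xor-identityʳ b))

  weight-corner-top : ∀ c → lookup c i ≡ false → lookup c j ≡ false →
                      weight (corner i j c true true) ≡ weight c + 2
  weight-corner-top c cᵢ cⱼ = begin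
    weight (flip i (flip j c)) ≡⟨ weight-flip i (flip j c) (trans (lookup∘updateAt′ i j i≢j c) cᵢ) ⟩
    weight (flip j c) + 1      ≡⟨ cong (_+ 1) (weight-flip j c cⱼ) ⟩
    weight c + 1 + 1           ≡⟨ +-assoc (weight c) 1 1 ⟩
    weight c + 2               ∎
    where open ≡-Reasoning

InSquare : Fin m → Fin m → Word m → Word m → Set
InSquare i j c z = ∃₂ λ a b → z ≡ corner i j c a b

InSquare-cases : InSquare i j c z →
  z ≡ corner i j c false false ⊎ z ≡ corner i j c true false ⊎
  z ≡ corner i j c true true ⊎ z ≡ corner i j c false true
InSquare-cases (false , false , e) = inj₁ e
InSquare-cases (true  , false , e) = inj₂ (inj₁ e)
InSquare-cases (true  , true  , e) = inj₂ (inj₂ (inj₁ e))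
InSquare-cases (false , true  , e) = inj₂ (inj₂ (inj₂ e))

∉-square : z ≢ corner i j c false false → z ≢ corner i j c true false → z ≢ corner i j c true true →
           z ≢ corner i j c false true → ¬ InSquare i j c z
∉-square z≢₀₀ _ _ _ (false , false , e) = z≢₀₀ e
∉-square _ z≢₁₀ _ _ (true  , false , e) = z≢₁₀ e
∉-square _ _ z≢₁₁ _ (true  , true  , e) = z≢₁₁ e
∉-square _ _ _ z≢₀₁ (false , true  , e) = z≢₀₁ e

CodeNeighbour : Code m → Word m → Word m → Set
CodeNeighbour C w v = C v ≡ true × dist w v ≡ 1

codeNeighbourᵇ : Code m → Word m → Word m → Bool
codeNeighbourᵇ C w v = C v ∧ (dist w v ≡ᵇ 1)

neighbours : Code m → Word m → List (Word m)
neighbours {m} C w = filterᵇ (codeNeighbourᵇ C w) (allWords m)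

∈-neighbours⁺ : (C : Code m) (w : Word m) → CodeNeighbour C w v → v ∈ neighbours C w
∈-neighbours⁺ {v = v} C w (cv , d) =
  ∈-filter⁺ (T? ∘ codeNeighbourᵇ C w) (∈-allWords v)
    (Equivalence.from T-∧ (Equivalence.from T-≡ cv , ≡⇒≡ᵇ _ _ d))

∈-neighbours⁻ : (C : Code m) (w : Word m) → v ∈ neighbours C w → CodeNeighbour C w v
∈-neighbours⁻ {m} C w v∈
  with Equivalence.to T-∧ (proj₂ (∈-filter⁻ (T? ∘ codeNeighbourᵇ C w) {xs = allWords m} v∈))
... | cv , d = Equivalence.to T-≡ cv , ≡ᵇ⇒≡ _ _ d

neighbours-unique : (C : Code m) (w : Word m) → Unique (neighbours C w)
neighbours-unique {m} C w = Unique.filter⁺ (T? ∘ codeNeighbourᵇ C w) (allWords-unique m)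

record SquareThrough (C : Code m) (x : Word m) : Set where
  field
    k l     : Fin m
    k≢l     : k ≢ l
    base    : Word m
    baseₖ   : lookup base k ≡ false
    baseₗ   : lookup base l ≡ false
    corners : ∀ a b → C (corner k l base a b) ≡ true
    x∈      : InSquare k l base x

module _ {C : Code m} (D : IsDiamond C) where
  open IsDiamond D

  codeword-of-two-codeword-neighbours : CodeNeighbour C w s → CodeNeighbour C w t → s ≢ t → C w ≡ true
  codeword-of-two-codeword-neighbours {w = w} ws wt s≢t with C w in cw
  ... | true  = refl
  ... | false =
    contradiction (∈-length≡1 (noncode-deg w cw) (∈-neighbours⁺ C w ws) (∈-neighbours⁺ C w wt)) s≢t

  codeword-neighbours-cover : C w ≡ true → CodeNeighbour C w s → CodeNeighbour C w t → s ≢ t →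
                              CodeNeighbour C w z → z ≡ s ⊎ z ≡ t
  codeword-neighbours-cover {w = w} cw ws wt s≢t wz =
    ∈-length≡2 (codeword-deg w cw) s≢t
      (∈-neighbours⁺ C w ws) (∈-neighbours⁺ C w wt) (∈-neighbours⁺ C w wz)

  codeword-has-two-codeword-flips : C x ≡ true →
                                    ∃₂ λ i j → i ≢ j × C (flip i x) ≡ true × C (flip j x) ≡ true
  codeword-has-two-codeword-flips {x = x} cx
    with unique-length≡2 (neighbours-unique C x) (codeword-deg x cx)
  ... | u , v , u≢v , u∈ , v∈ with ∈-neighbours⁻ C x u∈ | ∈-neighbours⁻ C x v∈
  ... | cu , du | cv , dv with dist≡1⇒flip x u du | dist≡1⇒flip x v dv
  ... | i , refl | j , refl = i , j , (λ { refl → u≢v refl }) , cu , cv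

  common-codeword-neighbour : C v ≡ true → C y ≡ true → dist v y ≡ 2 →
                              ∃ λ u → CodeNeighbour C v u × CodeNeighbour C u y
  common-codeword-neighbour {v = v} {y} cv cy d with dist≡2⇒flip² v y d
  ... | i , j , refl = flip j v , (cu , dist-flip j v) , (cy , dist-flip i (flip j v))
    where
    v≢y : v ≢ flip i (flip j v)
    v≢y e = contradiction (trans (sym (dist-self v)) (subst (λ y → dist v y ≡ 2) (sym e) d)) λ ()
    cu : C (flip j v) ≡ true
    cu = codeword-of-two-codeword-neighbours (cv , trans (dist-comm (flip j v) v) (dist-flip j v))
                                             (cy , dist-flip i (flip j v)) v≢y

  closed⇒dist≥3 : (S : Word m → Set) → (∀ {v z} → S v → CodeNeighbour C v z → S z) →
                  S v → C v ≡ true → C y ≡ true → ¬ S y → 3 ≤ dist y v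
  closed⇒dist≥3 {v = v} {y = y} S closed v∈S cv cy y∉S =
    subst (3 ≤_) (dist-comm v y) (far (dist v y) refl)
    where
    far : ∀ n → dist v y ≡ n → 3 ≤ n
    far 0 d = contradiction (subst S (dist≡0⇒≡ v y d) v∈S) y∉S
    far 1 d = contradiction (closed v∈S (cy , d)) y∉S
    far 2 d with common-codeword-neighbour cv cy d
    ... | u , vu , uy = contradiction (closed (closed v∈S vu) uy) y∉S
    far (suc (suc (suc n))) _ = m≤m+n 3 n

  square-closed : i ≢ j → (∀ a b → C (corner i j c a b) ≡ true) →
                  InSquare i j c v → CodeNeighbour C v z → InSquare i j c z
  square-closed {c = c} i≢j corners (a , b , refl) vz
    with codeword-neighbours-cover (corners a b) (corners (not a) b , dist-cornerˡ i≢j c a b)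
           (corners a (not b) , dist-cornerʳ i≢j c a b) (corner-neighbours-distinct i≢j c a b) vz
  ... | inj₁ z≡ = not a , b , z≡
  ... | inj₂ z≡ = a , not b , z≡

  codeword-square : i ≢ j → C x ≡ true → C (flip i x) ≡ true → C (flip j x) ≡ true →
                    ∀ a b → C (corner i j x a b) ≡ true
  codeword-square i≢j cx _   _   false false = cx
  codeword-square i≢j _  cix _   true  false = cix
  codeword-square i≢j _  _   cjx false true  = cjx
  codeword-square {x = x} i≢j _ cix cjx true true =
    codeword-of-two-codeword-neighbours (cjx , dist-cornerˡ i≢j x true true)
      (cix , dist-cornerʳ i≢j x true true) (corner-neighbours-distinct i≢j x true true)

  codeword-on-square : C x ≡ true → SquareThrough C x
  codeword-on-square {x = x} cx with codeword-has-two-codeword-flips cx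
  ... | i , j , i≢j , cix , cjx = record
    { k≢l     = i≢j
    ; base    = base
    ; baseₖ   = trans (lookup-cornerˡ i≢j x p q) (xor-same p)
    ; baseₗ   = trans (lookup-cornerʳ i≢j x p q) (xor-same q)
    ; corners = λ a b → subst (λ w → C w ≡ true) (sym (corner-corner i≢j x p q a b))
                              (codeword-square i≢j cx cix cjx (a xor p) (b xor q))
    ; x∈      = p , q , sym (trans (corner-corner i≢j x p q p q)
                                   (cong₂ (corner i j x) (xor-same p) (xor-same q)))
    }
    where
    -- flipping i and j exactly where x has a 1 clears both coordinates
    p q : Bool
    p = lookup x i
    q = lookup x j
    base : Word _
    base = corner i j x p q

corollary1 : (r : ℕ) → r ≥ 2 →
    (C : Code (2 ^ r + 1)) → IsDiamond C → size C ≡ 2 * 2 ^ (2 ^ r ∸ r) →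
    ∀ x → C x ≡ true →
    Σ (Word (2 ^ r + 1)) λ c0 → Σ (Word (2 ^ r + 1)) λ c1 →
    Σ (Word (2 ^ r + 1)) λ c2 → Σ (Word (2 ^ r + 1)) λ c3 → Σ ℕ λ k →
      (C c0 ≡ true × C c1 ≡ true × C c2 ≡ true × C c3 ≡ true)
      × (x ≡ c0 ⊎ x ≡ c1 ⊎ x ≡ c2 ⊎ x ≡ c3)
      × (c0 ≢ c1 × c0 ≢ c2 × c0 ≢ c3 × c1 ≢ c2 × c1 ≢ c3 × c2 ≢ c3)
      × (dist c0 c1 ≡ 1 × dist c1 c2 ≡ 1 × dist c2 c3 ≡ 1 × dist c3 c0 ≡ 1)
      × (k ≤ 2 ^ r ∸ 1)
      × (weight c0 ≡ k × weight c1 ≡ k + 1 × weight c3 ≡ k + 1 × weight c2 ≡ k + 2)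
      × (∀ y → C y ≡ true → y ≢ c0 → y ≢ c1 → y ≢ c2 → y ≢ c3 →
           dist y c0 ≥ 3 × dist y c1 ≥ 3 × dist y c2 ≥ 3 × dist y c3 ≥ 3)
corollary1 r _ C D _ x cx =
  c₀₀ , c₁₀ , c₁₁ , c₀₁ , weight base ,
  (corners false false , corners true false , corners true true , corners false true) ,
  InSquare-cases x∈ ,
  (≢-at (bitₖ false false) (bitₖ true false) , ≢-at (bitₖ false false) (bitₖ true true) ,
   ≢-at (bitₗ false false) (bitₗ false true) , ≢-at (bitₗ true false) (bitₗ true true) ,
   ≢-at (bitₖ true false) (bitₖ false true) , ≢-at (bitₖ true true) (bitₖ false true)) ,
  (dist-cornerˡ k≢l base false false , dist-cornerʳ k≢l base true false ,
   dist-cornerˡ k≢l base true true , dist-cornerʳ k≢l base false true) ,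
  m+2≤n+1⇒m≤n∸1 _ (2 ^ r) (subst (_≤ 2 ^ r + 1) weight₁₁ (weight≤length c₁₁)) ,
  (refl , weight-flip k base baseₖ , weight-flip l base baseₗ , weight₁₁) ,
  λ y cy y≢₀₀ y≢₁₀ y≢₁₁ y≢₀₁ → let y∉ = ∉-square y≢₀₀ y≢₁₀ y≢₁₁ y≢₀₁ in
    far cy y∉ false false , far cy y∉ true false , far cy y∉ true true , far cy y∉ false true
  where
  open SquareThrough (codeword-on-square D cx)
  c₀₀ c₁₀ c₁₁ c₀₁ : Word (2 ^ r + 1)
  c₀₀ = corner k l base false false
  c₁₀ = corner k l base true false
  c₁₁ = corner k l base true true
  c₀₁ = corner k l base false true
  weight₁₁ : weight c₁₁ ≡ weight base + 2
  weight₁₁ = weight-corner-top k≢l base baseₖ baseₗ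
  bitₖ : ∀ a b → lookup (corner k l base a b) k ≡ a
  bitₖ = lookup-base-cornerˡ k≢l baseₖ
  bitₗ : ∀ a b → lookup (corner k l base a b) l ≡ b
  bitₗ = lookup-base-cornerʳ k≢l baseₗ
  far : ∀ {y} → C y ≡ true → ¬ InSquare k l base y → ∀ a b → 3 ≤ dist y (corner k l base a b)
  far cy y∉ a b =
    closed⇒dist≥3 D (InSquare k l base) (square-closed D k≢l corners) (a , b , refl) (corners a b) cy y∉
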